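{- Let $n$ be a positive integer and $a,b\in\mathbb{Z}$ with $\gcd(a,b,n)=1$. Let $\Lambda:=\{(u,v)\in\mathbb{Z}^2\mid au+bv\in n\mathbb{Z}\}$. The circulant digraph $\vec C(n;a,b)$ is Hamiltonian if and only if the set $\Lambda\cap\{(x,y)\in\mathbb{N}^2\mid x+y=n\}$ contains a point visible in $\Lambda$.
   Context: The circulant digraph $\vec C(n;a,b)$ has vertex set $\mathbb{Z}/n\mathbb{Z}$ and, for every vertex $x$, an arc $x\to x+a$ and an arc $x\to x+b$ (jumps taken modulo $n$; loops and multiple arcs allowed). It is Hamiltonian if it contains a directed circuit visiting every vertex exactly once. $\mathbb{N}=\{0,1,2,\dots\}$. A point $\mathbf{v}\in\Lambda$ is visible in $\Lambda$ if the segment from $\mathbf{0}$ to $\mathbf{v}$ contains no point of $\Lambda$ other than its endpoints. -}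

module Defs where

open import Data.Nat using (ℕ; suc; NonZero; _%_)
open import Data.Fin using (Fin; toℕ)
open import Data.Integer as ℤ using (ℤ; +_)
open import Data.Integer.Divisibility using (_∣_)
open import Data.Integer.GCD using (gcd)
open import Data.Rational as ℚ using (ℚ; 0ℚ; 1ℚ)
open import Data.Product using (Σ; ∃; _×_; _,_)
open import Data.Sum using (_⊎_)
open import Relation.Binary.PropositionalEquality using (_≡_)
open import Function.Definitions using (Injective)

infix 4 _≡[_]_
_≡[_]_ : ℤ → ℤ → ℤ → Set
x ≡[ m ] y = m ∣ (y ℤ.- x)

Arc : (n : ℕ) → ℤ → ℤ → Fin n → Fin n → Set
Arc n a b x y =
  ((+ toℕ x) ℤ.+ a ≡[ + n ] + toℕ y) ⊎ ((+ toℕ x) ℤ.+ b ≡[ + n ] + toℕ y)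

-- A Hamiltonian circuit: a listing v 0, v 1, …, v (n-1) of the vertices,
-- each exactly once (v injective Fin n → Fin n, hence bijective), such that
-- v i → v (i+1 mod n) is an arc for every i (including the closing arc).
HamiltonianCirculant : (n : ℕ) → .{{NonZero n}} → ℤ → ℤ → Set
HamiltonianCirculant n a b =
  Σ (Fin n → Fin n) λ v →
    Injective _≡_ _≡_ v ×
    (∀ (i j : Fin n) → suc (toℕ i) % n ≡ toℕ j → Arc n a b (v i) (v j))

InΛ : ℕ → ℤ → ℤ → ℤ × ℤ → Set
InΛ n a b (u , v) = (+ n) ∣ (a ℤ.* u ℤ.+ b ℤ.* v)

ι : ℤ → ℚ
ι z = z ℚ./ 1

OnSegment : ℤ × ℤ → ℤ × ℤ → Set
OnSegment (p , q) (u , v) =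
  Σ ℚ λ t → (0ℚ ℚ.≤ t) × (t ℚ.≤ 1ℚ) × (ι p ≡ t ℚ.* ι u) × (ι q ≡ t ℚ.* ι v)

VisibleIn : (ℤ × ℤ → Set) → ℤ × ℤ → Set
VisibleIn Λ w =
  ∀ (z : ℤ × ℤ) → Λ z → OnSegment z w → (z ≡ (+ 0 , + 0)) ⊎ (z ≡ w)

module Submission where

-- A directed walk from 0 is encoded by p(i), the number of a-steps among its
-- first i steps; it sits at a·p(i) + b·(i − p(i)), and two of its positions are
-- congruent mod n iff the steps taken in between form a point of Λ (walk-≋⇔Λ).
-- The converse direction builds the circuit from a visible (x,y) with the
-- balanced choice p(i) = ⌊ix/n⌋: a repeated vertex would give a point of Λ whose
-- determinant with (x,y) is divisible by n (Λ-det, using gcd(a,b,n) = 1) but is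
-- a difference of residues, hence zero, so the point lies strictly inside the
-- segment from 0 to (x,y). The forward direction reads p off the circuit; a
-- point of Λ inside the segment would, by a discrete intermediate value
-- argument on the periodic "defect" n·p(i) − x·i, make the circuit revisit a
-- vertex.

open import Defs
open import Data.Nat as ℕ using (ℕ; zero; suc; z≤n; s≤s; NonZero)
import Data.Nat.Properties as ℕP
import Data.Nat.DivMod as ℕDM
import Data.Nat.Divisibility as ℕD
import Data.Nat.GCD as ℕG
import Data.Nat.Coprimality as ℕC
open import Data.Integer using (ℤ; +_; -[1+_]; _+_; _*_; _-_; -_; _≤_; +≤+; ∣_∣)
import Data.Integer.Properties as ℤP
import Data.Integer.DivMod as ℤDM
import Data.Integer.Divisibility.Signed as ℤD
import Data.Rational as ℚ
open import Data.Rational using (mkℚ; ↥_; ↧_)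
import Data.Rational.Properties as ℚP
open import Data.Rational.Unnormalised as ℚᵘ using (mkℚᵘ; *≡*; *≤*)
import Data.Rational.Unnormalised.Properties as ℚᵘP
open import Data.Integer.GCD using (gcd)
open import Data.Integer.Tactic.RingSolver using (solve-∀)
import Data.Nat.Tactic.RingSolver as ℕSolver
open import Data.Product using (Σ; _×_; _,_; proj₁; proj₂)
open import Data.Sum using (_⊎_; inj₁; inj₂)
open import Data.Empty using (⊥; ⊥-elim)
open import Data.Fin using (Fin; toℕ; fromℕ<)
import Data.Fin.Properties as FinP
open import Relation.Nullary using (yes; no)
open import Relation.Binary.Definitions using (tri<; tri≈; tri>)
open import Function.Bundles using (_⇔_; mk⇔; Equivalence)
open import Relation.Binary.Bundles using (Setoid)
import Relation.Binary.Reasoning.Setoid as SetoidReasoning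
open import Relation.Binary.PropositionalEquality

-- Congruence modulo n on ℤ: n divides v − u (signed divisibility, so that the
-- library's closure properties of divisibility apply). It is wrapped in a
-- record so that u and v can be inferred from a goal u ≋ v.
module Congruence (n : ℕ) where

  infix 4 _≋_
  record _≋_ (u v : ℤ) : Set where
    constructor ≋-intro
    field n∣difference : + n ℤD.∣ (v - u)

  ∣-resp : ∀ {z z′} → z ≡ z′ → + n ℤD.∣ z → + n ℤD.∣ z′
  ∣-resp refl d = d

  ≋⇒≡[] : ∀ {u v} → u ≋ v → u ≡[ + n ] v
  ≋⇒≡[] (≋-intro d) = ℤD.∣⇒∣ᵤ d

  ≡[]⇒≋ : ∀ {u v} → u ≡[ + n ] v → u ≋ v
  ≡[]⇒≋ d = ≋-intro (ℤD.∣ᵤ⇒∣ d)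

  ≋-reflexive : ∀ {u v} → u ≡ v → u ≋ v
  ≋-reflexive {u} refl = ≋-intro (∣-resp (sym (ℤP.+-inverseʳ u)) (ℤD.∣n⇒∣m*n (+ 0) (ℤD.∣-refl {+ n})))

  ≋-refl : ∀ {u} → u ≋ u
  ≋-refl = ≋-reflexive refl

  ≋-sym : ∀ {u v} → u ≋ v → v ≋ u
  ≋-sym {u} {v} (≋-intro d) = ≋-intro (∣-resp (identity u v) (ℤD.∣m⇒∣-m d))
    where identity : ∀ u v → - (v - u) ≡ u - v
          identity = solve-∀

  ≋-trans : ∀ {u v w} → u ≋ v → v ≋ w → u ≋ w
  ≋-trans {u} {v} {w} (≋-intro d) (≋-intro e) = ≋-intro (∣-resp (identity u v w) (ℤD.∣m∣n⇒∣m+n d e))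
    where identity : ∀ u v w → (v - u) + (w - v) ≡ w - u
          identity = solve-∀

  ≋-+ : ∀ {u v u′ v′} → u ≋ v → u′ ≋ v′ → u + u′ ≋ v + v′
  ≋-+ {u} {v} {u′} {v′} (≋-intro d) (≋-intro e) = ≋-intro (∣-resp (identity u v u′ v′) (ℤD.∣m∣n⇒∣m+n d e))
    where identity : ∀ u v u′ v′ → (v - u) + (v′ - u′) ≡ (v + v′) - (u + u′)
          identity = solve-∀

  ≋-cancelˡ : ∀ {u s t} → u + s ≋ u + t → s ≋ t
  ≋-cancelˡ {u} {s} {t} (≋-intro d) = ≋-intro (∣-resp (identity u s t) d)
    where identity : ∀ u s t → (u + t) - (u + s) ≡ t - s
          identity = solve-∀

  ≋-setoid : Setoid _ _
  ≋-setoid = record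
    { Carrier = ℤ ; _≈_ = _≋_
    ; isEquivalence = record { refl = ≋-refl ; sym = ≋-sym ; trans = ≋-trans } }

  module ≋-Reasoning = SetoidReasoning ≋-setoid

  ≋-residues : ∀ {u v} → u ℕ.< n → v ℕ.< n → + u ≋ + v → u ≡ v
  ≋-residues {u} {v} u<n v<n (≋-intro d) =
    sym (ℤP.+-injective (ℤP.i-j≡0⇒i≡j (+ v) (+ u) (ℤP.∣i∣≡0⇒i≡0 ∣v-u∣≡0)))
    where
    ∣v-u∣<n : ∣ + v - + u ∣ ℕ.< n
    ∣v-u∣<n = ℕP.≤-<-trans (subst (ℕ._≤ v ℕ.⊔ u) (cong ∣_∣ (sym (ℤP.[+m]-[+n]≡m⊖n v u))) (ℤP.∣m⊝n∣≤m⊔n v u))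
                          (ℕP.⊔-lub v<n u<n)
    ∣v-u∣≡0 : ∣ + v - + u ∣ ≡ 0
    ∣v-u∣≡0 with ∣ + v - + u ∣ | ℤD.∣⇒∣ᵤ d | ∣v-u∣<n
    ... | zero  | _ | _ = refl
    ... | suc _ | n∣ | lt = ⊥-elim (ℕD.>⇒∤ lt n∣)

  %ℕ-≋ : .{{_ : NonZero n}} → ∀ z → + (z ℤDM.%ℕ n) ≋ z
  %ℕ-≋ z = ≋-intro (ℤD.divides (z ℤDM./ℕ n)
    (trans (cong (_- + (z ℤDM.%ℕ n)) (ℤDM.a≡a%ℕn+[a/ℕn]*n z n))
           (identity (+ (z ℤDM.%ℕ n)) (z ℤDM./ℕ n) (+ n))))
    where identity : ∀ r q m → (r + q * m) - r ≡ q * m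
          identity = solve-∀

-- If n is coprime to gcd(a,b) and divides both a·d and b·d, then n divides d
-- (n divides gcd(ad,bd) = gcd(a,b)·d).
coprime-cancel : (n : ℕ) (a b d : ℤ) → gcd (gcd a b) (+ n) ≡ + 1 →
  + n ℤD.∣ (a * d) → + n ℤD.∣ (b * d) → + n ℤD.∣ d
coprime-cancel n a b d gcd≡1 n∣ad n∣bd = ℤD.∣ᵤ⇒∣ (ℕC.coprime-divisor n⊥gcd[a,b] n∣gcd[a,b]d)
  where
  A B D : ℕ
  A = ∣ a ∣
  B = ∣ b ∣
  D = ∣ d ∣
  n∣D* : ∀ c → + n ℤD.∣ (c * d) → n ℕD.∣ D ℕ.* ∣ c ∣
  n∣D* c n∣cd = subst (n ℕD.∣_) (trans (ℤP.abs-* c d) (ℕP.*-comm ∣ c ∣ D)) (ℤD.∣⇒∣ᵤ n∣cd)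
  n∣gcd[a,b]d : n ℕD.∣ ℕG.gcd A B ℕ.* D
  n∣gcd[a,b]d = subst (n ℕD.∣_)
    (trans (sym (ℕG.c*gcd[m,n]≡gcd[cm,cn] D A B)) (ℕP.*-comm D (ℕG.gcd A B)))
    (ℕG.gcd-greatest (n∣D* a n∣ad) (n∣D* b n∣bd))
  n⊥gcd[a,b] : ℕC.Coprime n (ℕG.gcd A B)
  n⊥gcd[a,b] = ℕC.sym (ℕC.gcd≡1⇒coprime (ℤP.+-injective gcd≡1))

-- For gcd(a,b,n) = 1 the determinant of two points of Λ is divisible by n:
-- n divides y(au+bv) − v(ax+by) = a(uy−vx) and u(ax+by) − x(au+bv) = b(uy−vx).
Λ-det : (n : ℕ) (a b : ℤ) → gcd (gcd a b) (+ n) ≡ + 1 → ∀ {u v x y} →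
  InΛ n a b (u , v) → InΛ n a b (x , y) → + n ℤD.∣ (u * y - v * x)
Λ-det n a b gcd≡1 {u} {v} {x} {y} uv∈Λ xy∈Λ = coprime-cancel n a b (u * y - v * x) gcd≡1
  (∣-resp (identityᵃ a b u v x y) (ℤD.∣m∣n⇒∣m-n (ℤD.∣n⇒∣m*n y n∣uv) (ℤD.∣n⇒∣m*n v n∣xy)))
  (∣-resp (identityᵇ a b u v x y) (ℤD.∣m∣n⇒∣m-n (ℤD.∣n⇒∣m*n u n∣xy) (ℤD.∣n⇒∣m*n x n∣uv)))
  where
  open Congruence n using (∣-resp)
  n∣uv : + n ℤD.∣ (a * u + b * v)
  n∣uv = ℤD.∣ᵤ⇒∣ uv∈Λ
  n∣xy : + n ℤD.∣ (a * x + b * y)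
  n∣xy = ℤD.∣ᵤ⇒∣ xy∈Λ
  identityᵃ : ∀ a b u v x y → y * (a * u + b * v) - v * (a * x + b * y) ≡ a * (u * y - v * x)
  identityᵃ = solve-∀
  identityᵇ : ∀ a b u v x y → u * (a * x + b * y) - x * (a * u + b * v) ≡ b * (u * y - v * x)
  identityᵇ = solve-∀

-- (p,q) = (m/D)·(u,v) with 0 ≤ m ≤ D and D > 0: the integral form of lying
-- on the segment from 0 to (u,v).
Proportional : ℤ × ℤ → ℤ × ℤ → Set
Proportional (p , q) (u , v) =
  Σ ℕ λ m → Σ ℕ λ e → m ℕ.≤ suc e × p * + suc e ≡ + m * u × q * + suc e ≡ + m * v

ι-unnormalised : ∀ p → ℚ.toℚᵘ (ι p) ℚᵘ.≃ mkℚᵘ p 0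
ι-unnormalised p = ℚP.toℚᵘ-fromℚᵘ (mkℚᵘ p 0)

ι-scaled⇒ : ∀ t p u → ι p ≡ t ℚ.* ι u → p * ↧ t ≡ ↥ t * u
ι-scaled⇒ t@(mkℚ N e _) p u eq
  with ℚᵘP.≃-trans (ℚᵘP.≃-sym (ι-unnormalised p)) (ℚᵘP.≃-trans (ℚP.toℚᵘ-cong eq)
         (ℚᵘP.≃-trans (ℚP.toℚᵘ-homo-* t (ι u)) (ℚᵘP.*-cong (ℚᵘP.≃-refl {mkℚᵘ N e}) (ι-unnormalised u))))
... | *≡* eq′ =
  trans (cong (λ z → p * + z) (sym (ℕP.*-identityʳ (suc e)))) (trans eq′ (ℤP.*-identityʳ (N * u)))

ι-scaled⇐ : ∀ m e p u → p * + suc e ≡ + m * u → ι p ≡ (+ m ℚ./ suc e) ℚ.* ι u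
ι-scaled⇐ m e p u eq = ℚP.toℚᵘ-injective (ℚᵘP.≃-trans (ι-unnormalised p) (ℚᵘP.≃-trans (*≡* eq′)
   (ℚᵘP.≃-sym (ℚᵘP.≃-trans (ℚP.toℚᵘ-homo-* (+ m ℚ./ suc e) (ι u))
     (ℚᵘP.*-cong (ℚP.toℚᵘ-fromℚᵘ (mkℚᵘ (+ m) e)) (ι-unnormalised u))))))
  where
  eq′ : p * + (suc e ℕ.* 1) ≡ (+ m * u) * + 1
  eq′ = trans (cong (λ z → p * + z) (ℕP.*-identityʳ (suc e))) (trans eq (sym (ℤP.*-identityʳ (+ m * u))))

0≤-numerator : ∀ t → ℚ.0ℚ ℚ.≤ t → + 0 ≤ ↥ t
0≤-numerator t@(mkℚ N e _) 0≤t =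
  ℤP.≤-trans (ℤP.≤-reflexive (sym (ℤP.*-zeroˡ (↧ t))))
    (ℤP.≤-trans (ℚP.drop-*≤* 0≤t) (ℤP.≤-reflexive (ℤP.*-identityʳ N)))

≤1-numerator : ∀ t → t ℚ.≤ ℚ.1ℚ → ↥ t ≤ ↧ t
≤1-numerator t@(mkℚ N e _) t≤1 =
  ℤP.≤-trans (ℤP.≤-reflexive (sym (ℤP.*-identityʳ N)))
    (ℤP.≤-trans (ℚP.drop-*≤* t≤1) (ℤP.≤-reflexive (ℤP.*-identityˡ (↧ t))))

onSegment⇔proportional : ∀ z w → OnSegment z w ⇔ Proportional z w
onSegment⇔proportional (p , q) (u , v) = mk⇔ to from
  where
  to : OnSegment (p , q) (u , v) → Proportional (p , q) (u , v)
  to (t@(mkℚ N e _) , 0≤t , t≤1 , p≡tu , q≡tv) with 0≤-numerator t 0≤t | ≤1-numerator t t≤1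
  ... | +≤+ {n = m} _ | +≤+ m≤D = m , e , m≤D , ι-scaled⇒ t p u p≡tu , ι-scaled⇒ t q v q≡tv
  from : Proportional (p , q) (u , v) → OnSegment (p , q) (u , v)
  from (m , e , m≤D , pD≡mu , qD≡mv) =
    (+ m ℚ./ suc e) , 0≤m/D , m/D≤1 , ι-scaled⇐ m e p u pD≡mu , ι-scaled⇐ m e q v qD≡mv
    where
    0≤m/D : ℚ.0ℚ ℚ.≤ (+ m ℚ./ suc e)
    0≤m/D = ℚP.toℚᵘ-cancel-≤ (ℚᵘP.≤-respʳ-≃ (ℚᵘP.≃-sym (ℚP.toℚᵘ-fromℚᵘ (mkℚᵘ (+ m) e)))
      (*≤* (ℤP.≤-trans (ℤP.≤-reflexive (ℤP.*-zeroˡ (+ suc e)))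
        (ℤP.≤-trans (+≤+ z≤n) (ℤP.≤-reflexive (sym (ℤP.*-identityʳ (+ m))))))))
    m/D≤1 : (+ m ℚ./ suc e) ℚ.≤ ℚ.1ℚ
    m/D≤1 = ℚP.toℚᵘ-cancel-≤ (ℚᵘP.≤-respˡ-≃ (ℚᵘP.≃-sym (ℚP.toℚᵘ-fromℚᵘ (mkℚᵘ (+ m) e)))
      (*≤* (ℤP.≤-trans (ℤP.≤-reflexive (ℤP.*-identityʳ (+ m)))
        (ℤP.≤-trans (+≤+ m≤D) (ℤP.≤-reflexive (sym (ℤP.*-identityˡ (+ suc e))))))))

parallel⇒proportional : ∀ u v X Y → u * Y ≡ v * X →
  u * (X + Y) ≡ (u + v) * X × v * (X + Y) ≡ (u + v) * Y
parallel⇒proportional u v X Y uY≡vX =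
    ℤP.i-j≡0⇒i≡j _ _ (trans (identityᵘ u v X Y) (ℤP.i≡j⇒i-j≡0 uY≡vX))
  , ℤP.i-j≡0⇒i≡j _ _ (trans (identityᵛ u v X Y) (cong -_ (ℤP.i≡j⇒i-j≡0 uY≡vX)))
  where
  identityᵘ : ∀ u v X Y → u * (X + Y) - (u + v) * X ≡ u * Y - v * X
  identityᵘ = solve-∀
  identityᵛ : ∀ u v X Y → v * (X + Y) - (u + v) * Y ≡ - (u * Y - v * X)
  identityᵛ = solve-∀

data SegmentPoint (x y : ℕ) : ℤ × ℤ → Set where
  origin   : SegmentPoint x y (+ 0 , + 0)
  endpoint : SegmentPoint x y (+ x , + y)
  interior : ∀ P Q → 0 ℕ.< P ℕ.+ Q → P ℕ.+ Q ℕ.< x ℕ.+ y →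
             P ℕ.* (x ℕ.+ y) ≡ (P ℕ.+ Q) ℕ.* x → SegmentPoint x y (+ P , + Q)

interior-point : ∀ {x y} P Q t e → 0 ℕ.< x ℕ.+ y → 0 ℕ.< t → t ℕ.< suc e →
  P ℕ.* suc e ≡ t ℕ.* x → Q ℕ.* suc e ≡ t ℕ.* y → SegmentPoint x y (+ P , + Q)
interior-point {x} {y} P Q t e 0<x+y 0<t t<D PD≡tx QD≡ty = interior P Q 0<P+Q P+Q<x+y proportional
  where
  D : ℕ
  D = suc e
  [P+Q]D≡t[x+y] : (P ℕ.+ Q) ℕ.* D ≡ t ℕ.* (x ℕ.+ y)
  [P+Q]D≡t[x+y] =
    trans (ℕP.*-distribʳ-+ D P Q) (trans (cong₂ ℕ._+_ PD≡tx QD≡ty) (sym (ℕP.*-distribˡ-+ t x y)))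
  0<P+Q : 0 ℕ.< P ℕ.+ Q
  0<P+Q = ℕP.*-cancelʳ-< D 0 (P ℕ.+ Q) (subst (0 ℕ.<_) (sym [P+Q]D≡t[x+y]) (ℕP.*-mono-< 0<t 0<x+y))
  P+Q<x+y : P ℕ.+ Q ℕ.< x ℕ.+ y
  P+Q<x+y = ℕP.*-cancelʳ-< D (P ℕ.+ Q) (x ℕ.+ y) (subst₂ ℕ._<_ (sym [P+Q]D≡t[x+y]) (ℕP.*-comm D (x ℕ.+ y))
    (ℕP.*-monoˡ-< (x ℕ.+ y) {{ℕ.>-nonZero 0<x+y}} t<D))
  proportional : P ℕ.* (x ℕ.+ y) ≡ (P ℕ.+ Q) ℕ.* x
  proportional = ℕP.*-cancelʳ-≡ _ _ D (begin
    P ℕ.* (x ℕ.+ y) ℕ.* D    ≡⟨ swap P (x ℕ.+ y) D ⟩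
    P ℕ.* D ℕ.* (x ℕ.+ y)    ≡⟨ cong (ℕ._* (x ℕ.+ y)) PD≡tx ⟩
    t ℕ.* x ℕ.* (x ℕ.+ y)    ≡⟨ rotate t x (x ℕ.+ y) ⟩
    x ℕ.* (t ℕ.* (x ℕ.+ y))  ≡⟨ cong (x ℕ.*_) [P+Q]D≡t[x+y] ⟨
    x ℕ.* ((P ℕ.+ Q) ℕ.* D)  ≡⟨ rotate (P ℕ.+ Q) x D ⟨
    (P ℕ.+ Q) ℕ.* x ℕ.* D    ∎)
    where
    open ≡-Reasoning
    swap : ∀ u v w → u ℕ.* v ℕ.* w ≡ u ℕ.* w ℕ.* v
    swap = ℕSolver.solve-∀
    rotate : ∀ u v w → u ℕ.* v ℕ.* w ≡ v ℕ.* (u ℕ.* w)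
    rotate = ℕSolver.solve-∀

multiple-point : ∀ {x y} P Q t e → 0 ℕ.< x ℕ.+ y → t ℕ.≤ suc e →
  P ℕ.* suc e ≡ t ℕ.* x → Q ℕ.* suc e ≡ t ℕ.* y → SegmentPoint x y (+ P , + Q)
multiple-point P Q zero e _ _ PD≡0 QD≡0
  rewrite ℕP.m*n≡0⇒m≡0 P (suc e) PD≡0 | ℕP.m*n≡0⇒m≡0 Q (suc e) QD≡0 = origin
multiple-point {x} {y} P Q (suc s) e 0<x+y t≤D PD≡tx QD≡ty with ℕP.m≤n⇒m<n∨m≡n t≤D
... | inj₁ t<D = interior-point P Q (suc s) e 0<x+y (s≤s z≤n) t<D PD≡tx QD≡ty
... | inj₂ refl rewrite ℕP.*-cancelʳ-≡ P x (suc e) (trans PD≡tx (ℕP.*-comm (suc e) x))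
                      | ℕP.*-cancelʳ-≡ Q y (suc e) (trans QD≡ty (ℕP.*-comm (suc e) y)) = endpoint

segment-point : ∀ x y z → 0 ℕ.< x ℕ.+ y → OnSegment z (+ x , + y) → SegmentPoint x y z
segment-point x y (A , B) 0<x+y seg with Equivalence.to (onSegment⇔proportional (A , B) (+ x , + y)) seg
... | t , e , t≤D , AD≡tx , BD≡ty =
  natural A B (trans AD≡tx (sym (ℤP.pos-* t x))) (trans BD≡ty (sym (ℤP.pos-* t y)))
  where
  natural : ∀ A B → A * + suc e ≡ + (t ℕ.* x) → B * + suc e ≡ + (t ℕ.* y) → SegmentPoint x y (A , B)
  natural (+ P) (+ Q) PD≡tx QD≡ty = multiple-point P Q t e 0<x+y t≤D
    (ℤP.+-injective (trans (ℤP.pos-* P (suc e)) PD≡tx)) (ℤP.+-injective (trans (ℤP.pos-* Q (suc e)) QD≡ty))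
  natural -[1+ _ ] _ () _
  natural (+ _) -[1+ _ ] _ ()

VisibleLinePoint : ℕ → ℤ → ℤ → Set
VisibleLinePoint n a b =
  Σ ℕ λ x → Σ ℕ λ y → (x ℕ.+ y ≡ n) × InΛ n a b (+ x , + y) × VisibleIn (InΛ n a b) (+ x , + y)

module Walk (n : ℕ) (a b : ℤ) where
  open Congruence n

  walk : (ℕ → ℕ) → ℕ → ℤ
  walk p i = a * + p i + b * (+ i - + p i)

  data Step (p : ℕ → ℕ) (i : ℕ) : Set where
    a-step : p (suc i) ≡ suc (p i) → Step p i
    b-step : p (suc i) ≡ p i → Step p i

  jump : ∀ {p i} → Step p i → ℤ
  jump (a-step _) = a
  jump (b-step _) = b

  walk-suc : ∀ p i (s : Step p i) → walk p (suc i) ≡ walk p i + jump s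
  walk-suc p i (a-step p↑) = begin
    a * + p (suc i) + b * (+ suc i - + p (suc i))     ≡⟨ cong (λ P → a * + P + b * (+ suc i - + P)) p↑ ⟩
    a * + suc (p i) + b * (+ suc i - + suc (p i))
      ≡⟨ cong₂ (λ P I → a * P + b * (I - P)) (ℤP.pos-+ 1 (p i)) (ℤP.pos-+ 1 i) ⟩
    a * (+ 1 + + p i) + b * ((+ 1 + + i) - (+ 1 + + p i)) ≡⟨ identity a b (+ p i) (+ i) ⟩
    walk p i + a ∎
    where open ≡-Reasoning
          identity : ∀ a b P I → a * (+ 1 + P) + b * ((+ 1 + I) - (+ 1 + P)) ≡ (a * P + b * (I - P)) + a
          identity = solve-∀
  walk-suc p i (b-step p→) = begin
    a * + p (suc i) + b * (+ suc i - + p (suc i)) ≡⟨ cong (λ P → a * + P + b * (+ suc i - + P)) p→ ⟩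
    a * + p i + b * (+ suc i - + p i)             ≡⟨ cong (λ I → a * + p i + b * (I - + p i)) (ℤP.pos-+ 1 i) ⟩
    a * + p i + b * ((+ 1 + + i) - + p i)         ≡⟨ identity a b (+ p i) (+ i) ⟩
    walk p i + b ∎
    where open ≡-Reasoning
          identity : ∀ a b P I → a * P + b * ((+ 1 + I) - P) ≡ (a * P + b * (I - P)) + b
          identity = solve-∀

  step-between : ∀ p i → p i ℕ.≤ p (suc i) → p (suc i) ℕ.≤ suc (p i) → Step p i
  step-between p i lower upper with ℕP.m≤n⇒m<n∨m≡n upper
  ... | inj₁ (s≤s p[1+i]≤p[i]) = b-step (ℕP.≤-antisym p[1+i]≤p[i] lower)
  ... | inj₂ p[1+i]≡1+p[i] = a-step p[1+i]≡1+p[i]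

  step⇒arc : ∀ {p i u v} (s : Step p i) → + toℕ u + jump s ≋ + toℕ v → Arc n a b u v
  step⇒arc (a-step _) u+a≋v = inj₁ (≋⇒≡[] u+a≋v)
  step⇒arc (b-step _) u+b≋v = inj₂ (≋⇒≡[] u+b≋v)

  a-steps b-steps : (ℕ → ℕ) → ℕ → ℕ → ℤ
  a-steps p i j = + p j - + p i
  b-steps p i j = (+ j - + p j) - (+ i - + p i)

  walk-≋⇔Λ : ∀ p i j → walk p i ≋ walk p j ⇔ InΛ n a b (a-steps p i j , b-steps p i j)
  walk-≋⇔Λ p i j = mk⇔ (λ (≋-intro d) → ℤD.∣⇒∣ᵤ (∣-resp difference d))
                       (λ d → ≋-intro (∣-resp (sym difference) (ℤD.∣ᵤ⇒∣ d)))
    where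
    difference : walk p j - walk p i ≡ a * a-steps p i j + b * b-steps p i j
    difference = identity a b (+ p i) (+ p j) (+ i) (+ j)
      where identity : ∀ a b Pᵢ Pⱼ I J →
              (a * Pⱼ + b * (J - Pⱼ)) - (a * Pᵢ + b * (I - Pᵢ)) ≡ a * (Pⱼ - Pᵢ) + b * ((J - Pⱼ) - (I - Pᵢ))
            identity = solve-∀

  walk-closed⇔Λ : ∀ p {N x y} → p 0 ≡ 0 → p N ≡ x → x ℕ.+ y ≡ N →
    walk p 0 ≋ walk p N ⇔ InΛ n a b (+ x , + y)
  walk-closed⇔Λ p {N} {x} {y} p0≡0 pN≡x x+y≡N =
    subst (λ w → walk p 0 ≋ walk p N ⇔ InΛ n a b w) steps (walk-≋⇔Λ p 0 N)
    where
    steps : (+ p N - + p 0 , (+ N - + p N) - (+ 0 - + p 0)) ≡ (+ x , + y)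
    steps rewrite p0≡0 | pN≡x | sym x+y≡N =
      cong₂ _,_ (ℤP.+-identityʳ (+ x))
                (trans (cong (_- + 0) (cong (_- + x) (ℤP.pos-+ x y))) (identity (+ x) (+ y)))
      where identity : ∀ X Y → ((X + Y) - X) - (+ 0 - + 0) ≡ Y
            identity = solve-∀

  -- n·p(i) − x·i measures how far the walk's share of a-steps deviates from x/n.
  defect : ℕ → (ℕ → ℕ) → ℕ → ℤ
  defect x p i = + p i * + n - + i * + x

  defect-difference : ∀ x p i j → defect x p j - defect x p i ≡ a-steps p i j * + n - (+ j - + i) * + x
  defect-difference x p i j = identity (+ p i) (+ p j) (+ i) (+ j) (+ n) (+ x)
    where identity : ∀ Pᵢ Pⱼ I J N X → (Pⱼ * N - J * X) - (Pᵢ * N - I * X) ≡ (Pⱼ - Pᵢ) * N - (J - I) * X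
          identity = solve-∀

discrete-ivt : (f : ℕ → ℤ) → (∀ i → f (suc i) ≤ f i + + 1) →
  ∀ d lo → f lo ≤ + 0 → + 0 ≤ f (lo ℕ.+ d) → Σ ℕ λ i → f i ≡ + 0
discrete-ivt f rise zero lo f≤0 0≤f = lo , ℤP.≤-antisym f≤0 (subst (λ i → + 0 ≤ f i) (ℕP.+-identityʳ lo) 0≤f)
discrete-ivt f rise (suc d) lo f≤0 0≤f with f lo ℤP.≟ + 0
... | yes f≡0 = lo , f≡0
... | no f≢0 = discrete-ivt f rise d (suc lo) f[1+lo]≤0 (subst (λ i → + 0 ≤ f i) (ℕP.+-suc lo d) 0≤f)
  where
  -- a negative integer plus one is still ≤ 0
  f[1+lo]≤0 : f (suc lo) ≤ + 0
  f[1+lo]≤0 = ℤP.≤-trans (rise lo)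
    (ℤP.≤-trans (ℤP.≤-reflexive (ℤP.+-comm (f lo) (+ 1))) (ℤP.i<j⇒suc[i]≤j (ℤP.≤∧≢⇒< f≤0 f≢0)))

max-upto : (g : ℕ → ℤ) → ∀ N → Σ ℕ λ i → i ℕ.≤ N × (∀ j → j ℕ.≤ N → g j ≤ g i)
max-upto g zero = zero , z≤n , λ { zero z≤n → ℤP.≤-refl }
max-upto g (suc N) with max-upto g N
... | i , i≤N , max with ℤP.≤-total (g (suc N)) (g i)
...   | inj₁ g[1+N]≤g[i] = i , ℕP.m≤n⇒m≤1+n i≤N , below
  where below : ∀ j → j ℕ.≤ suc N → g j ≤ g i
        below j j≤1+N with ℕP.m≤n⇒m<n∨m≡n j≤1+N
        ... | inj₁ (s≤s j≤N) = max j j≤N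
        ... | inj₂ refl = g[1+N]≤g[i]
...   | inj₂ g[i]≤g[1+N] = suc N , ℕP.≤-refl , below
  where below : ∀ j → j ℕ.≤ suc N → g j ≤ g (suc N)
        below j j≤1+N with ℕP.m≤n⇒m<n∨m≡n j≤1+N
        ... | inj₁ (s≤s j≤N) = ℤP.≤-trans (max j j≤N) g[i]≤g[1+N]
        ... | inj₂ refl = ℤP.≤-refl

periodic-% : (g : ℕ → ℤ) → ∀ n .{{_ : NonZero n}} → (∀ i → g (i ℕ.+ n) ≡ g i) → ∀ j → g j ≡ g (j ℕ.% n)
periodic-% g n period j = trans (cong g (ℕDM.m≡m%n+[m/n]*n j n)) (shift (j ℕ.% n) (j ℕ./ n))
  where
  shift : ∀ r q → g (r ℕ.+ q ℕ.* n) ≡ g r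
  shift r zero = cong g (ℕP.+-identityʳ r)
  shift r (suc q) = trans (cong g (rearrange r q n)) (trans (period (r ℕ.+ q ℕ.* n)) (shift r q))
    where rearrange : ∀ r q n → r ℕ.+ (n ℕ.+ q ℕ.* n) ≡ r ℕ.+ q ℕ.* n ℕ.+ n
          rearrange = ℕSolver.solve-∀

periodic-max : (g : ℕ → ℤ) → ∀ n .{{_ : NonZero n}} → (∀ i → g (i ℕ.+ n) ≡ g i) →
  Σ ℕ λ i → i ℕ.< n × (∀ j → g j ≤ g i)
periodic-max g n@(suc k) period with max-upto g k
... | i , i≤k , max = i , s≤s i≤k , λ j →
  subst (_≤ g i) (sym (periodic-% g n period j)) (max (j ℕ.% n) (ℕP.≤-pred (ℕDM.m%n<n j n)))

periodic-min : (g : ℕ → ℤ) → ∀ n .{{_ : NonZero n}} → (∀ i → g (i ℕ.+ n) ≡ g i) →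
  Σ ℕ λ i → i ℕ.< n × (∀ j → g i ≤ g j)
periodic-min g n period with periodic-max (λ i → - g i) n (λ i → cong -_ (period i))
... | i , i<n , max = i , i<n , λ j → ℤP.neg-cancel-≤ (max j)

module PointToCircuit (k : ℕ) (a b : ℤ) (gcd≡1 : gcd (gcd a b) (+ suc k) ≡ + 1)
  (x y : ℕ) (x+y≡n : x ℕ.+ y ≡ suc k) (xy∈Λ : InΛ (suc k) a b (+ x , + y))
  (visible : VisibleIn (InΛ (suc k) a b) (+ x , + y)) where

  n : ℕ
  n = suc k

  open Congruence n
  open Walk n a b

  p r : ℕ → ℕ
  p i = (i ℕ.* x) ℕ./ n
  r i = (i ℕ.* x) ℕ.% n

  -- ⌊ix/n⌋ grows by at most one per step since x ≤ n.
  p-step : ∀ i → Step p i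
  p-step i = step-between p i (ℕDM./-monoˡ-≤ n (ℕP.m≤n+m (i ℕ.* x) x)) (begin
    (x ℕ.+ i ℕ.* x) ℕ./ n       ≤⟨ ℕDM./-monoˡ-≤ n (ℕP.+-monoˡ-≤ (i ℕ.* x) x≤n) ⟩
    (n ℕ.+ i ℕ.* x) ℕ./ n       ≡⟨ ℕDM.+-distrib-/-∣ˡ (i ℕ.* x) (ℕD.∣-refl {n}) ⟩
    n ℕ./ n ℕ.+ p i             ≡⟨ cong (ℕ._+ p i) (ℕDM.n/n≡1 n) ⟩
    suc (p i)                   ∎)
    where
    open ℕP.≤-Reasoning
    x≤n : x ℕ.≤ n
    x≤n = subst (x ℕ.≤_) x+y≡n (ℕP.m≤m+n x y)

  defect≡-r : ∀ i → defect x p i ≡ - + r i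
  defect≡-r i = begin
    + p i * + n - + i * + x             ≡⟨ cong (λ z → + p i * + n - z) (sym (ℤP.pos-* i x)) ⟩
    + p i * + n - + (i ℕ.* x)           ≡⟨ cong (λ z → + p i * + n - + z) (ℕDM.m≡m%n+[m/n]*n (i ℕ.* x) n) ⟩
    + p i * + n - + (r i ℕ.+ p i ℕ.* n)
      ≡⟨ cong (λ z → + p i * + n - z) (trans (ℤP.pos-+ (r i) _) (cong (λ z → + r i + z) (ℤP.pos-* (p i) n))) ⟩
    + p i * + n - (+ r i + + p i * + n) ≡⟨ identity (+ p i * + n) (+ r i) ⟩
    - + r i                             ∎
    where open ≡-Reasoning
          identity : ∀ Q R → Q - (R + Q) ≡ - R
          identity = solve-∀

  -- The walk is closed: after n steps it has taken x a-steps and y b-steps.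
  closed : walk p 0 ≋ walk p n
  closed = Equivalence.from (walk-closed⇔Λ p (ℕDM.0/n≡0 n) p[n]≡x x+y≡n) xy∈Λ
    where p[n]≡x : p n ≡ x
          p[n]≡x = trans (cong (ℕ._/ n) (ℕP.*-comm n x)) (ℕDM.m*n/n≡m x n)

  x+y≡n′ : + x + + y ≡ + n
  x+y≡n′ = trans (sym (ℤP.pos-+ x y)) (cong +_ x+y≡n)

  r<n : ∀ i → r i ℕ.< n
  r<n i = ℕDM.m%n<n (i ℕ.* x) n

  -- Between two congruent positions the steps taken are parallel to (x,y):
  -- their determinant with (x,y) is divisible by n (Λ-det) and equals the
  -- difference r i − r j of two residues, hence vanishes.
  returns-parallel : ∀ i j → walk p i ≋ walk p j → a-steps p i j * + y ≡ b-steps p i j * + x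
  returns-parallel i j wᵢ≋wⱼ =
    ℤP.i-j≡0⇒i≡j _ _ (trans det≡rᵢ-rⱼ (trans (cong (λ z → + r i - + z) rⱼ≡rᵢ) (ℤP.+-inverseʳ (+ r i))))
    where
    open ≡-Reasoning
    A B : ℤ
    A = a-steps p i j
    B = b-steps p i j
    det≡rᵢ-rⱼ : A * + y - B * + x ≡ + r i - + r j
    det≡rᵢ-rⱼ = begin
      A * + y - B * + x                 ≡⟨ identity (+ p i) (+ p j) (+ i) (+ j) (+ x) (+ y) ⟩
      A * (+ x + + y) - (+ j - + i) * + x ≡⟨ cong (λ z → A * z - (+ j - + i) * + x) x+y≡n′ ⟩
      A * + n - (+ j - + i) * + x       ≡⟨ sym (defect-difference x p i j) ⟩
      defect x p j - defect x p i       ≡⟨ cong₂ _-_ (defect≡-r j) (defect≡-r i) ⟩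
      - + r j - - + r i                 ≡⟨ swap (+ r i) (+ r j) ⟩
      + r i - + r j                     ∎
      where
      identity : ∀ Pᵢ Pⱼ I J X Y →
        (Pⱼ - Pᵢ) * Y - ((J - Pⱼ) - (I - Pᵢ)) * X ≡ (Pⱼ - Pᵢ) * (X + Y) - (J - I) * X
      identity = solve-∀
      swap : ∀ Rᵢ Rⱼ → - Rⱼ - - Rᵢ ≡ Rᵢ - Rⱼ
      swap = solve-∀
    rⱼ≡rᵢ : r j ≡ r i
    rⱼ≡rᵢ = ≋-residues (r<n j) (r<n i)
      (≋-intro (∣-resp det≡rᵢ-rⱼ (Λ-det n a b gcd≡1 (Equivalence.to (walk-≋⇔Λ p i j) wᵢ≋wⱼ) xy∈Λ)))

  -- Within fewer than n steps the walk never returns to a vertex: the steps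
  -- taken would form the point ((j−i)/n)·(x,y) of Λ strictly inside the segment.
  no-return : ∀ {i j} → i ℕ.< j → j ℕ.< n → walk p i ≋ walk p j → ⊥
  no-return {i} {j} i<j j<n wᵢ≋wⱼ = not-endpoint (visible (A , B) AB∈Λ on-segment)
    where
    A B : ℤ
    A = a-steps p i j
    B = b-steps p i j
    d : ℕ
    d = j ℕ.∸ i
    AB∈Λ : InΛ n a b (A , B)
    AB∈Λ = Equivalence.to (walk-≋⇔Λ p i j) wᵢ≋wⱼ
    A+B≡d : A + B ≡ + d
    A+B≡d = trans (identity (+ p i) (+ p j) (+ i) (+ j)) (trans (ℤP.[+m]-[+n]≡m⊖n j i) (ℤP.⊖-≥ (ℕP.<⇒≤ i<j)))
      where identity : ∀ Pᵢ Pⱼ I J → (Pⱼ - Pᵢ) + ((J - Pⱼ) - (I - Pᵢ)) ≡ J - I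
            identity = solve-∀
    d<n : d ℕ.< n
    d<n = ℕP.≤-<-trans (ℕP.m∸n≤m j i) j<n
    on-segment : OnSegment (A , B) (+ x , + y)
    on-segment = Equivalence.from (onSegment⇔proportional (A , B) (+ x , + y))
      (d , k , ℕP.<⇒≤ d<n , scale A (+ x) (proj₁ proportional) , scale B (+ y) (proj₂ proportional))
      where
      proportional : A * (+ x + + y) ≡ (A + B) * + x × B * (+ x + + y) ≡ (A + B) * + y
      proportional = parallel⇒proportional A B (+ x) (+ y) (returns-parallel i j wᵢ≋wⱼ)
      scale : ∀ C X → C * (+ x + + y) ≡ (A + B) * X → C * + n ≡ + d * X
      scale C X eq = trans (cong (C *_) (sym x+y≡n′)) (trans eq (cong (_* X) A+B≡d))
    sum : ∀ {u v} → (A , B) ≡ (u , v) → A + B ≡ u + v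
    sum refl = refl
    not-endpoint : (A , B) ≡ (+ 0 , + 0) ⊎ (A , B) ≡ (+ x , + y) → ⊥
    not-endpoint (inj₁ at-0) = ℕP.<⇒≢ (ℕP.m<n⇒0<n∸m i<j) (sym (ℤP.+-injective d≡0))
      where d≡0 : + d ≡ + 0
            d≡0 = trans (sym A+B≡d) (sum at-0)
    not-endpoint (inj₂ at-xy) = ℕP.<⇒≢ d<n (ℤP.+-injective d≡n)
      where d≡n : + d ≡ + n
            d≡n = trans (sym A+B≡d) (trans (sum at-xy) x+y≡n′)

  -- Step i (for i < n) leads to position (i+1) mod n, using closedness at i+1 = n.
  next-≋ : ∀ i j → i ℕ.< n → suc i ℕ.% n ≡ j → walk p (suc i) ≋ walk p j
  next-≋ i j i<n [1+i]%n≡j with ℕP.m≤n⇒m<n∨m≡n i<n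
  ... | inj₁ 1+i<n = ≋-reflexive (cong (walk p) (trans (sym (ℕDM.m<n⇒m%n≡m 1+i<n)) [1+i]%n≡j))
  ... | inj₂ refl = ≋-trans (≋-sym closed) (≋-reflexive (cong (walk p) (trans (sym (ℕDM.n%n≡0 n)) [1+i]%n≡j)))

  vertex : Fin n → Fin n
  vertex f = fromℕ< (ℤDM.n%ℕd<d (walk p (toℕ f)) n)

  vertex-≋ : ∀ f → + toℕ (vertex f) ≋ walk p (toℕ f)
  vertex-≋ f = subst (λ v → + v ≋ walk p (toℕ f)) (sym (FinP.toℕ-fromℕ< _)) (%ℕ-≋ (walk p (toℕ f)))

  arcs : ∀ f g → suc (toℕ f) ℕ.% n ≡ toℕ g → Arc n a b (vertex f) (vertex g)
  arcs f g [1+f]%n≡g = step⇒arc s (begin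
    + toℕ (vertex f) + jump s  ≈⟨ ≋-+ (vertex-≋ f) ≋-refl ⟩
    walk p (toℕ f) + jump s    ≡⟨ walk-suc p (toℕ f) s ⟨
    walk p (suc (toℕ f))       ≈⟨ next-≋ (toℕ f) (toℕ g) (FinP.toℕ<n f) [1+f]%n≡g ⟩
    walk p (toℕ g)             ≈⟨ vertex-≋ g ⟨
    + toℕ (vertex g)           ∎)
    where
    open ≋-Reasoning
    s : Step p (toℕ f)
    s = p-step (toℕ f)

  same-vertex⇒≋ : ∀ f g → vertex f ≡ vertex g → walk p (toℕ f) ≋ walk p (toℕ g)
  same-vertex⇒≋ f g vf≡vg =
    ≋-trans (≋-sym (vertex-≋ f)) (≋-trans (≋-reflexive (cong (λ v → + toℕ v) vf≡vg)) (vertex-≋ g))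

  -- A repeated vertex would be a return of the walk within fewer than n steps.
  injective : ∀ {f g} → vertex f ≡ vertex g → f ≡ g
  injective {f} {g} vf≡vg with ℕP.<-cmp (toℕ f) (toℕ g)
  ... | tri< f<g _ _ = ⊥-elim (no-return f<g (FinP.toℕ<n g) (same-vertex⇒≋ f g vf≡vg))
  ... | tri≈ _ f≡g _ = FinP.toℕ-injective f≡g
  ... | tri> _ _ g<f = ⊥-elim (no-return g<f (FinP.toℕ<n f) (same-vertex⇒≋ g f (sym vf≡vg)))

  circuit : HamiltonianCirculant n a b
  circuit = vertex , injective , arcs

-- Let p(i) count the a-arcs
-- among the first i arcs of the circuit (run periodically from v 0); then the
-- i-th vertex is v 0 + walk p i, so (x,y) = (p n, n − p n) lies in Λ. If a point
-- (P,Q) of Λ lay strictly inside the segment, with m = P + Q, the integer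
-- c(i) = p(i+m) − p(i) − P satisfies n·c(i) = defect(i+m) − defect(i) for the
-- periodic defect; so c ≤ 0 at a maximum and c ≥ 0 at a minimum of the defect,
-- and since c rises by at most one per step it vanishes somewhere. There the
-- circuit would revisit a vertex after m < n steps.
module CircuitToPoint (k : ℕ) (a b : ℤ) (v : Fin (suc k) → Fin (suc k))
  (v-injective : ∀ {f g} → v f ≡ v g → f ≡ g)
  (arc : ∀ f g → suc (toℕ f) ℕ.% suc k ≡ toℕ g → Arc (suc k) a b (v f) (v g)) where

  n : ℕ
  n = suc k

  open Congruence n
  open Walk n a b

  fin : ℕ → Fin n
  fin i = fromℕ< (ℕDM.m%n<n i n)

  toℕ-fin : ∀ i → toℕ (fin i) ≡ i ℕ.% n
  toℕ-fin i = FinP.toℕ-fromℕ< _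

  fin-periodic : ∀ i → fin (i ℕ.+ n) ≡ fin i
  fin-periodic i =
    FinP.toℕ-injective (trans (toℕ-fin (i ℕ.+ n)) (trans (ℕDM.[m+n]%n≡m%n i n) (sym (toℕ-fin i))))

  succ : Fin n → Fin n
  succ f = fin (suc (toℕ f))

  succ-fin : ∀ i → succ (fin i) ≡ fin (suc i)
  succ-fin i = FinP.toℕ-injective (begin
    toℕ (succ (fin i))                    ≡⟨ toℕ-fin (suc (toℕ (fin i))) ⟩
    suc (toℕ (fin i)) ℕ.% n               ≡⟨ cong (λ r → suc r ℕ.% n) (toℕ-fin i) ⟩
    suc (i ℕ.% n) ℕ.% n                   ≡⟨ ℕDM.[m+kn]%n≡m%n (suc (i ℕ.% n)) (i ℕ./ n) n ⟨
    suc (i ℕ.% n ℕ.+ i ℕ./ n ℕ.* n) ℕ.% n ≡⟨ cong (λ j → suc j ℕ.% n) (ℕDM.m≡m%n+[m/n]*n i n) ⟨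
    suc i ℕ.% n                           ≡⟨ toℕ-fin (suc i) ⟨
    toℕ (fin (suc i))                     ∎)
    where open ≡-Reasoning

  leave : ∀ f → Arc n a b (v f) (v (succ f))
  leave f = arc f (succ f) (sym (toℕ-fin (suc (toℕ f))))

  is-a : ∀ {u w} → Arc n a b u w → ℕ
  is-a (inj₁ _) = 1
  is-a (inj₂ _) = 0

  p : ℕ → ℕ
  p zero = 0
  p (suc i) = is-a (leave (fin i)) ℕ.+ p i

  vertex : ℕ → ℤ
  vertex i = + toℕ (v (fin i))

  step : ∀ i → Σ (Step p i) λ s → vertex i + jump s ≋ vertex (suc i)
  step i = classify (leave (fin i)) refl
    where
    classify : (e : Arc n a b (v (fin i)) (v (succ (fin i)))) → p (suc i) ≡ is-a e ℕ.+ p i →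
               Σ (Step p i) λ s → vertex i + jump s ≋ vertex (suc i)
    classify (inj₁ i+a≡) p↑ = a-step p↑ , subst (λ f → vertex i + a ≋ + toℕ (v f)) (succ-fin i) (≡[]⇒≋ i+a≡)
    classify (inj₂ i+b≡) p→ = b-step p→ , subst (λ f → vertex i + b ≋ + toℕ (v f)) (succ-fin i) (≡[]⇒≋ i+b≡)

  vertex-walk : ∀ i → vertex 0 + walk p i ≋ vertex i
  vertex-walk zero =
    ≋-reflexive (trans (cong (λ w → vertex 0 + w) (identity a b)) (ℤP.+-identityʳ (vertex 0)))
    where identity : ∀ a b → a * + 0 + b * (+ 0 - + 0) ≡ + 0
          identity = solve-∀
  vertex-walk (suc i) with step i
  ... | s , i+s≋1+i = begin
    vertex 0 + walk p (suc i)       ≡⟨ cong (λ w → vertex 0 + w) (walk-suc p i s) ⟩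
    vertex 0 + (walk p i + jump s)  ≡⟨ ℤP.+-assoc (vertex 0) (walk p i) (jump s) ⟨
    vertex 0 + walk p i + jump s    ≈⟨ ≋-+ (vertex-walk i) ≋-refl ⟩
    vertex i + jump s               ≈⟨ i+s≋1+i ⟩
    vertex (suc i)                  ∎
    where open ≋-Reasoning

  walk-≋⇒vertex-≋ : ∀ i j → walk p i ≋ walk p j → vertex i ≋ vertex j
  walk-≋⇒vertex-≋ i j wᵢ≋wⱼ =
    ≋-trans (≋-sym (vertex-walk i)) (≋-trans (≋-+ (≋-refl {vertex 0}) wᵢ≋wⱼ) (vertex-walk j))

  vertex-≋⇒walk-≋ : ∀ i j → vertex i ≋ vertex j → walk p i ≋ walk p j
  vertex-≋⇒walk-≋ i j vᵢ≋vⱼ =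
    ≋-cancelˡ {vertex 0} (≋-trans (vertex-walk i) (≋-trans vᵢ≋vⱼ (≋-sym (vertex-walk j))))

  is-a≤1 : ∀ {u w} (e : Arc n a b u w) → is-a e ℕ.≤ 1
  is-a≤1 (inj₁ _) = s≤s z≤n
  is-a≤1 (inj₂ _) = z≤n

  p-mono : ∀ i → p i ℕ.≤ p (suc i)
  p-mono i = ℕP.m≤n+m (p i) (is-a (leave (fin i)))

  p-rise : ∀ i → p (suc i) ℕ.≤ suc (p i)
  p-rise i = ℕP.+-monoˡ-≤ (p i) (is-a≤1 (leave (fin i)))

  p≤ : ∀ i → p i ℕ.≤ i
  p≤ zero = z≤n
  p≤ (suc i) = ℕP.≤-trans (p-rise i) (s≤s (p≤ i))

  x y : ℕ
  x = p n
  y = n ℕ.∸ x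

  x+y≡n : x ℕ.+ y ≡ n
  x+y≡n = ℕP.m+[n∸m]≡n (p≤ n)

  -- After n arcs the circuit is back at v 0, so (x,y) ∈ Λ.
  xy∈Λ : InΛ n a b (+ x , + y)
  xy∈Λ = Equivalence.to (walk-closed⇔Λ p refl refl x+y≡n)
    (vertex-≋⇒walk-≋ 0 n (≋-reflexive (cong (λ f → + toℕ (v f)) (sym (fin-periodic 0)))))

  p-periodic : ∀ i → p (i ℕ.+ n) ≡ p i ℕ.+ x
  p-periodic zero = refl
  p-periodic (suc i) = trans (cong₂ ℕ._+_ (cong (λ f → is-a (leave f)) (fin-periodic i)) (p-periodic i))
                             (sym (ℕP.+-assoc (is-a (leave (fin i))) (p i) x))

  defect-periodic : ∀ i → defect x p (i ℕ.+ n) ≡ defect x p i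
  defect-periodic i =
    trans (cong₂ (λ P I → P * + n - I * + x) (trans (cong +_ (p-periodic i)) (ℤP.pos-+ (p i) x)) (ℤP.pos-+ i n))
          (identity (+ p i) (+ i) (+ n) (+ x))
    where identity : ∀ P I N X → (P + X) * N - (I + N) * X ≡ P * N - I * X
          identity = solve-∀

  fin-shift : ∀ i {m} → 0 ℕ.< m → m ℕ.< n → fin i ≡ fin (i ℕ.+ m) → ⊥
  fin-shift i {m} 0<m m<n fᵢ≡fᵢ₊ₘ = ℕP.<⇒≢ 0<m (≋-residues (s≤s z≤n) m<n (≋-cancelˡ {+ i} (begin
    + i + + 0            ≡⟨ ℤP.+-identityʳ (+ i) ⟩
    + i                  ≈⟨ %ℕ-≋ (+ i) ⟨
    + (i ℕ.% n)          ≡⟨ cong +_ (trans (sym (toℕ-fin i)) (trans (cong toℕ fᵢ≡fᵢ₊ₘ) (toℕ-fin (i ℕ.+ m)))) ⟩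
    + ((i ℕ.+ m) ℕ.% n)  ≈⟨ %ℕ-≋ (+ (i ℕ.+ m)) ⟩
    + (i ℕ.+ m)          ≡⟨ ℤP.pos-+ i m ⟩
    + i + + m            ∎)))
    where open ≋-Reasoning

  module Interior (P Q : ℕ) (PQ∈Λ : InΛ n a b (+ P , + Q)) (0<m : 0 ℕ.< P ℕ.+ Q) (m<n : P ℕ.+ Q ℕ.< n)
                  (Pn≡mx : P ℕ.* n ≡ (P ℕ.+ Q) ℕ.* x) where

    m : ℕ
    m = P ℕ.+ Q

    c : ℕ → ℤ
    c i = a-steps p i (i ℕ.+ m) - + P

    n·c : ∀ i → c i * + n ≡ defect x p (i ℕ.+ m) - defect x p i
    n·c i = begin
      (A - + P) * + n                     ≡⟨ distrib A (+ P) (+ n) ⟩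
      A * + n - + P * + n
        ≡⟨ cong (λ z → A * + n - z) (trans (sym (ℤP.pos-* P n)) (trans (cong +_ Pn≡mx) (ℤP.pos-* m x))) ⟩
      A * + n - + m * + x                 ≡⟨ cong (λ z → A * + n - z * + x) [i+m]-i≡m ⟨
      A * + n - (+ (i ℕ.+ m) - + i) * + x ≡⟨ defect-difference x p i (i ℕ.+ m) ⟨
      defect x p (i ℕ.+ m) - defect x p i ∎
      where
      open ≡-Reasoning
      A : ℤ
      A = a-steps p i (i ℕ.+ m)
      distrib : ∀ A P N → (A - P) * N ≡ A * N - P * N
      distrib = solve-∀
      [i+m]-i≡m : + (i ℕ.+ m) - + i ≡ + m
      [i+m]-i≡m = trans (cong (_- + i) (ℤP.pos-+ i m)) (identity (+ i) (+ m))
        where identity : ∀ I M → (I + M) - I ≡ M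
              identity = solve-∀

    c-rise : ∀ i → c (suc i) ≤ c i + + 1
    c-rise i = ℤP.≤-trans (ℤP.+-mono-≤ (ℤP.+-mono-≤ p[1+j]≤1+p[j] (ℤP.neg-mono-≤ (+≤+ (p-mono i)))) ℤP.≤-refl)
                          (ℤP.≤-reflexive (identity (+ p (i ℕ.+ m)) (+ p i) (+ P)))
      where
      p[1+j]≤1+p[j] : + p (suc (i ℕ.+ m)) ≤ + 1 + + p (i ℕ.+ m)
      p[1+j]≤1+p[j] = ℤP.≤-trans (+≤+ (p-rise (i ℕ.+ m))) (ℤP.≤-reflexive (ℤP.pos-+ 1 (p (i ℕ.+ m))))
      identity : ∀ Pⱼ Pᵢ P → ((+ 1 + Pⱼ) - Pᵢ) - P ≡ ((Pⱼ - Pᵢ) - P) + + 1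
      identity = solve-∀

    c-periodic : ∀ i → c (i ℕ.+ n) ≡ c i
    c-periodic i = begin
      (+ p (i ℕ.+ n ℕ.+ m) - + p (i ℕ.+ n)) - + P   ≡⟨ cong (λ j → (+ p j - + p (i ℕ.+ n)) - + P) (swap i n m) ⟩
      (+ p (i ℕ.+ m ℕ.+ n) - + p (i ℕ.+ n)) - + P
        ≡⟨ cong₂ (λ Pⱼ Pᵢ → (+ Pⱼ - + Pᵢ) - + P) (p-periodic (i ℕ.+ m)) (p-periodic i) ⟩
      (+ (p (i ℕ.+ m) ℕ.+ x) - + (p i ℕ.+ x)) - + P
        ≡⟨ cong₂ (λ Pⱼ Pᵢ → (Pⱼ - Pᵢ) - + P) (ℤP.pos-+ (p (i ℕ.+ m)) x) (ℤP.pos-+ (p i) x) ⟩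
      ((+ p (i ℕ.+ m) + + x) - (+ p i + + x)) - + P ≡⟨ identity (+ p (i ℕ.+ m)) (+ p i) (+ x) (+ P) ⟩
      c i                                           ∎
      where
      open ≡-Reasoning
      swap : ∀ i n m → i ℕ.+ n ℕ.+ m ≡ i ℕ.+ m ℕ.+ n
      swap = ℕSolver.solve-∀
      identity : ∀ Pⱼ Pᵢ X P → ((Pⱼ + X) - (Pᵢ + X)) - P ≡ (Pⱼ - Pᵢ) - P
      identity = solve-∀

    c≤0 : ∀ i → defect x p (i ℕ.+ m) ≤ defect x p i → c i ≤ + 0
    c≤0 i le = ℤP.*-cancelʳ-≤-pos (c i) (+ 0) (+ n) (ℤP.≤-trans (ℤP.≤-reflexive (n·c i)) (ℤP.i≤j⇒i-j≤0 le))

    0≤c : ∀ i → defect x p i ≤ defect x p (i ℕ.+ m) → + 0 ≤ c i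
    0≤c i le =
      ℤP.*-cancelʳ-≤-pos (+ 0) (c i) (+ n) (ℤP.≤-trans (ℤP.i≤j⇒0≤j-i le) (ℤP.≤-reflexive (sym (n·c i))))

    c-vanishes : Σ ℕ λ i → c i ≡ + 0
    c-vanishes = discrete-ivt c c-rise (i₁ ℕ.+ n ℕ.∸ i₀) i₀ (c≤0 i₀ (max (i₀ ℕ.+ m))) 0≤c[i₁+n]
      where
      maximum : Σ ℕ λ i → i ℕ.< n × (∀ j → defect x p j ≤ defect x p i)
      maximum = periodic-max (defect x p) n defect-periodic
      minimum : Σ ℕ λ i → i ℕ.< n × (∀ j → defect x p i ≤ defect x p j)
      minimum = periodic-min (defect x p) n defect-periodic
      i₀ i₁ : ℕ
      i₀ = proj₁ maximum
      i₁ = proj₁ minimum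
      max : ∀ j → defect x p j ≤ defect x p i₀
      max = proj₂ (proj₂ maximum)
      min : ∀ j → defect x p i₁ ≤ defect x p j
      min = proj₂ (proj₂ minimum)
      i₀+[i₁+n∸i₀]≡i₁+n : i₀ ℕ.+ (i₁ ℕ.+ n ℕ.∸ i₀) ≡ i₁ ℕ.+ n
      i₀+[i₁+n∸i₀]≡i₁+n = ℕP.m+[n∸m]≡n (ℕP.≤-trans (ℕP.<⇒≤ (proj₁ (proj₂ maximum))) (ℕP.m≤n+m n i₁))
      0≤c[i₁+n] : + 0 ≤ c (i₀ ℕ.+ (i₁ ℕ.+ n ℕ.∸ i₀))
      0≤c[i₁+n] = subst (λ j → + 0 ≤ c j) (sym i₀+[i₁+n∸i₀]≡i₁+n)
                    (subst (+ 0 ≤_) (sym (c-periodic i₁)) (0≤c i₁ (min (i₁ ℕ.+ m))))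

    revisits-at : ∀ i → c i ≡ + 0 → ⊥
    revisits-at i c≡0 = fin-shift i 0<m m<n (v-injective (FinP.toℕ-injective same-vertex))
      where
      A≡P : a-steps p i (i ℕ.+ m) ≡ + P
      A≡P = ℤP.i-j≡0⇒i≡j (a-steps p i (i ℕ.+ m)) (+ P) c≡0
      B≡Q : b-steps p i (i ℕ.+ m) ≡ + Q
      B≡Q = begin
        (+ (i ℕ.+ m) - + p (i ℕ.+ m)) - (+ i - + p i)
          ≡⟨ cong (λ z → (z - + p (i ℕ.+ m)) - (+ i - + p i)) (ℤP.pos-+ i m) ⟩
        ((+ i + + m) - + p (i ℕ.+ m)) - (+ i - + p i) ≡⟨ identity (+ i) (+ m) (+ p i) (+ p (i ℕ.+ m)) ⟩
        + m - a-steps p i (i ℕ.+ m)                   ≡⟨ cong (λ z → + m - z) A≡P ⟩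
        + m - + P                                     ≡⟨ cong (_- + P) (ℤP.pos-+ P Q) ⟩
        (+ P + + Q) - + P                             ≡⟨ cancel (+ P) (+ Q) ⟩
        + Q                                           ∎
        where
        open ≡-Reasoning
        identity : ∀ I M Pᵢ Pⱼ → ((I + M) - Pⱼ) - (I - Pᵢ) ≡ M - (Pⱼ - Pᵢ)
        identity = solve-∀
        cancel : ∀ P Q → (P + Q) - P ≡ Q
        cancel = solve-∀
      wᵢ≋wᵢ₊ₘ : walk p i ≋ walk p (i ℕ.+ m)
      wᵢ≋wᵢ₊ₘ = Equivalence.from (walk-≋⇔Λ p i (i ℕ.+ m)) (subst (InΛ n a b) (sym (cong₂ _,_ A≡P B≡Q)) PQ∈Λ)
      same-vertex : toℕ (v (fin i)) ≡ toℕ (v (fin (i ℕ.+ m)))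
      same-vertex = ≋-residues (FinP.toℕ<n (v (fin i))) (FinP.toℕ<n (v (fin (i ℕ.+ m))))
                      (walk-≋⇒vertex-≋ i (i ℕ.+ m) wᵢ≋wᵢ₊ₘ)

    revisits : ⊥
    revisits = revisits-at (proj₁ c-vanishes) (proj₂ c-vanishes)

  visible : VisibleIn (InΛ n a b) (+ x , + y)
  visible z z∈Λ z-on-segment with segment-point x y z (subst (0 ℕ.<_) (sym x+y≡n) (s≤s z≤n)) z-on-segment
  ... | origin = inj₁ refl
  ... | endpoint = inj₂ refl
  ... | interior P Q 0<m m<x+y P[x+y]≡mx =
    ⊥-elim (Interior.revisits P Q z∈Λ 0<m (subst (P ℕ.+ Q ℕ.<_) x+y≡n m<x+y)
                              (subst (λ N → P ℕ.* N ≡ (P ℕ.+ Q) ℕ.* x) x+y≡n P[x+y]≡mx))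

  visible-point : VisibleLinePoint n a b
  visible-point = x , y , x+y≡n , xy∈Λ , visible

mainTheorem4 : (n : ℕ) → .{{_ : NonZero n}} → (a b : ℤ) →
    gcd (gcd a b) (+ n) ≡ + 1 →
    HamiltonianCirculant n a b ⇔
      Σ ℕ (λ x → Σ ℕ (λ y →
        (x ℕ.+ y ≡ n) × InΛ n a b (+ x , + y) × VisibleIn (InΛ n a b) (+ x , + y)))
mainTheorem4 (suc k) a b gcd≡1 = mk⇔
  (λ (v , v-injective , arcs) → CircuitToPoint.visible-point k a b v v-injective arcs)
  (λ (x , y , x+y≡n , xy∈Λ , visible) → PointToCircuit.circuit k a b gcd≡1 x y x+y≡n xy∈Λ visible)
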